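{- Let $r\geqslant 2$ and let $\pi,\beta\in\mathrm{Sym}_n$ with $w_H(\pi)=w_H(\beta)=2r-1\leqslant n$. Suppose $Ts(\pi)=Ts(\beta)$ and that $\beta$ has a cycle $(y_1\,y_2\,\ldots\,y_t)$ such that $\pi$ consists of all the other cycles of $\beta$ together with the two cycles $(y_1\,y_2\,\ldots\,y_s)$ and $(y_{s+1}\,\ldots\,y_t)$, where $s\leqslant t-2$. Then $|N_1(\pi)|\geqslant|N_1(\beta)|$ and $|N_2(\pi)|\geqslant|N_2(\beta)|$.
   Context: $\mathrm{Sym}_n$ is the symmetric group on $[n]=\{1,\dots,n\}$, $w_H(\pi)=|\{i:\pi(i)\neq i\}|$ the Hamming weight. For $\pi\in\mathrm{Sym}_n$: $Ts(\pi)=\{i\in[n]:\pi(i)\neq i\}$ and $Tc(\pi)=\{(i,\pi(i)) : i\in[n],\ \pi(i)\neq i\}$. "Cycles" of a permutation mean its cycles of length at least two in its disjoint cycle decomposition. For $\pi$ with $w_H(\pi)=2r-1$: $N_1(\pi)=\{\sigma\in\mathrm{Sym}_n: Tc(\sigma)\subset Tc(\pi),\ |Tc(\sigma)|=r-1\}$ and $N_2(\pi)=\{\sigma\in\mathrm{Sym}_n: Tc(\sigma)\subset Tc(\pi),\ |Tc(\sigma)|=r\}$. -}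

module Defs where

open import Data.Nat using (ℕ; zero; suc; _∸_)
import Data.Nat as ℕ
open import Data.Fin using (Fin; _≟_)
open import Data.Fin.Properties using (all?)
open import Data.Fin.Permutation using (Permutation′; _⟨$⟩ʳ_)
open import Data.Vec using (Vec; []; _∷_; lookup)
open import Data.List using (List; []; _∷_; [_]; map; concatMap; filter; length; allFin)
open import Data.Product using (_×_; _,_)
open import Relation.Nullary using (Dec; ¬_; ¬?)
open import Relation.Nullary.Decidable using (_×-dec_; _→-dec_)
open import Relation.Binary.PropositionalEquality using (_≡_; _≢_)

Fun : ℕ → Set
Fun n = Fin n → Fin n

perm : ∀ {n} → Permutation′ n → Fun n
perm π = π ⟨$⟩ʳ_

_∈Ts_ : ∀ {n} → Fin n → Fun n → Set
i ∈Ts f = f i ≢ i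

_,_∈Tc_ : ∀ {n} → Fin n → Fin n → Fun n → Set
i , j ∈Tc f = (f i ≡ j) × (f i ≢ i)

∈Tc? : ∀ {n} (f : Fun n) (i j : Fin n) → Dec (i , j ∈Tc f)
∈Tc? f i j = (f i ≟ j) ×-dec ¬? (f i ≟ i)

wH : ∀ {n} → Fun n → ℕ
wH {n} f = length (filter (λ i → ¬? (f i ≟ i)) (allFin n))

allPairs : ∀ n → List (Fin n × Fin n)
allPairs n = concatMap (λ i → map (λ j → (i , j)) (allFin n)) (allFin n)

∣Tc∣ : ∀ {n} → Fun n → ℕ
∣Tc∣ {n} f = length (filter (λ { (i , j) → ∈Tc? f i j }) (allPairs n))

TcSub : ∀ {n} → Fun n → Fun n → Set
TcSub {n} σ π = ∀ i j → i , j ∈Tc σ → i , j ∈Tc π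

TcSub? : ∀ {n} (σ π : Fun n) → Dec (TcSub σ π)
TcSub? σ π = all? λ i → all? λ j → ∈Tc? σ i j →-dec ∈Tc? π i j

allVecs : ∀ n m → List (Vec (Fin n) m)
allVecs n zero = [ [] ]
allVecs n (suc m) = concatMap (λ x → map (x ∷_) (allVecs n m)) (allFin n)

Injective? : ∀ {n} (f : Fun n) → Dec (∀ i j → f i ≡ f j → i ≡ j)
Injective? f = all? λ i → all? λ j → (f i ≟ f j) →-dec (i ≟ j)

Sym : ∀ n → List (Fun n)
Sym n = map lookup (filter (λ v → Injective? (lookup v)) (allVecs n n))

∣N∣ : ∀ {n} → ℕ → Fun n → ℕ
∣N∣ {n} m π = length (filter (λ σ → TcSub? σ π ×-dec (∣Tc∣ σ ℕ.≟ m)) (Sym n))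

-- N_1(π) for w_H(π) = 2r-1: |Tc(σ)| = r - 1 ; N_2(π): |Tc(σ)| = r
∣N₁∣ : ∀ {n} → ℕ → Fun n → ℕ
∣N₁∣ r π = ∣N∣ (r ∸ 1) π

∣N₂∣ : ∀ {n} → ℕ → Fun n → ℕ
∣N₂∣ r π = ∣N∣ r π

-- Let Tc(σ) ⊆ Tc(β) with σ a permutation. Then σ agrees with β on its support, so the support is
-- β-invariant, i.e. a union of β-cycles. Since π maps every point into its own β-cycle, the support
-- is π-invariant as well, and σ ↦ (π on the support of σ, identity elsewhere) is an injection of
-- N_m(β) into N_m(π) for every m; it keeps the support because π moves every point that β moves.

module Submission where

open import Defs
open import Data.Nat using (ℕ; suc; _+_; _*_; _∸_; _≤_; _<_)
open import Data.Fin using (Fin)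
open import Data.Fin.Permutation using (Permutation′)
open import Data.Product using (_×_)
open import Function.Bundles using (_⇔_)
open import Relation.Binary.PropositionalEquality using (_≡_; _≢_)

open import Data.Bool using (true; false)
open import Data.Empty using (⊥-elim)
open import Data.Fin using (_≟_)
open import Data.List using (List; []; _∷_; [_]; _++_; map; filter; length; allFin; concatMap; cartesianProductWith)
open import Data.List.Membership.Propositional using (_∈_)
open import Data.List.Membership.Propositional.Properties using (∈-filter⁺; ∈-filter⁻; ∈-allFin; ∈-cartesianProductWith⁺)
open import Data.List.Properties using (filter-++; length-++; filter-≐; filter-none; filter-accept; filter-reject; filter-notAll)
open import Data.List.Relation.Unary.All as All using (All)
open import Data.List.Relation.Unary.AllPairs using ([]; _∷_)
open import Data.List.Relation.Unary.Any as Any using (here; there)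
open import Data.List.Relation.Unary.Unique.Propositional using (Unique)
open import Data.List.Relation.Unary.Unique.Propositional.Properties using (cartesianProductWith⁺; allFin⁺; filter⁺)
open import Data.Nat using (zero; z≤n; s≤s; _≤′_; ≤′-refl; ≤′-step)
open import Data.Nat.Properties using (≤-trans; ≤-refl; <⇒≤; ≤-pred; <-cmp; m≤n⇒m<n∨m≡n; m∸n≤m; ≤⇒≤′; anyUpTo?)
open import Data.Product using (_,_; proj₁; proj₂; ∃-syntax)
open import Data.Sum using (inj₁; inj₂)
open import Data.Vec using (Vec; []; _∷_; lookup; tabulate)
open import Data.Vec.Properties using (lookup∘tabulate; tabulate∘lookup; tabulate-cong; ≡-dec)
open import Function.Base using (_∘_)
open import Function.Bundles using (Injection; Equivalence)
open import Function.Definitions using (Injective)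
open import Function.Properties.Inverse using (↔⇒↣)
open import Relation.Binary.Construct.Closure.ReflexiveTransitive using (Star; ε; _◅_; _◅◅_)
open import Relation.Binary.Definitions using (DecidableEquality; tri<; tri≈; tri>)
open import Relation.Binary.PropositionalEquality using (refl; sym; trans; cong; cong₂; subst; subst₂; _≗_; module ≡-Reasoning)
open import Relation.Nullary using (Dec; yes; no; ¬?; does; contradiction)
open import Relation.Unary using (Decidable)

private variable
  A B : Set
  n : ℕ

length-filter-map : {P : B → Set} (P? : Decidable P) (h : A → B) (xs : List A) →
  length (filter P? (map h xs)) ≡ length (filter (P? ∘ h) xs)
length-filter-map P? h [] = refl
length-filter-map P? h (x ∷ xs) with does (P? (h x))
... | true = cong suc (length-filter-map P? h xs)
... | false = length-filter-map P? h xs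

length-filter-≟-Unique : (_≟A_ : DecidableEquality A) (a : A) {xs : List A} →
  Unique xs → a ∈ xs → length (filter (a ≟A_) xs) ≡ 1
length-filter-≟-Unique _≟A_ a {a ∷ xs} (a∉xs ∷ _) (here refl) =
  trans (cong length (filter-accept (a ≟A_) refl))
        (cong (suc ∘ length) (filter-none (a ≟A_) a∉xs))
length-filter-≟-Unique _≟A_ a {x ∷ xs} (x∉xs ∷ xs!) (there a∈xs) =
  trans (cong length (filter-reject (a ≟A_) λ { refl → All.lookup x∉xs a∈xs refl }))
        (length-filter-≟-Unique _≟A_ a xs! a∈xs)

module _ (_≟B_ : DecidableEquality B) where

  length-≤-injection : (g : A → B) {xs : List A} {ys : List B} → Unique xs →
    (∀ {x} → x ∈ xs → g x ∈ ys) →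
    (∀ {x x′} → x ∈ xs → x′ ∈ xs → g x ≡ g x′ → x ≡ x′) →
    length xs ≤ length ys
  length-≤-injection g {[]} _ _ _ = z≤n
  length-≤-injection g {x ∷ xs} {ys} (x∉xs ∷ xs!) maps cancel =
    ≤-trans (s≤s (length-≤-injection g xs! maps′ (λ m m′ → cancel (there m) (there m′))))
            (filter-notAll (λ z → ¬? (z ≟B g x)) ys
              (Any.map (λ gx≡z z≢gx → z≢gx (sym gx≡z)) (maps (here refl))))
    where
    maps′ : ∀ {x′} → x′ ∈ xs → g x′ ∈ filter (λ z → ¬? (z ≟B g x)) ys
    maps′ x′∈xs = ∈-filter⁺ (λ z → ¬? (z ≟B g x)) (maps (there x′∈xs))
      (λ gx′≡gx → All.lookup x∉xs x′∈xs (cancel (here refl) (there x′∈xs) (sym gx′≡gx)))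

concatMap-map≡cartesianProductWith : {C : Set} (f : A → B → C) (xs : List A) (ys : List B) →
  concatMap (λ x → map (f x) ys) xs ≡ cartesianProductWith f xs ys
concatMap-map≡cartesianProductWith f [] ys = refl
concatMap-map≡cartesianProductWith f (x ∷ xs) ys =
  cong (map (f x) ys ++_) (concatMap-map≡cartesianProductWith f xs ys)

allVecs-Unique : ∀ n m → Unique (allVecs n m)
allVecs-Unique n zero = All.[] ∷ []
allVecs-Unique n (suc m) =
  subst Unique (sym (concatMap-map≡cartesianProductWith _∷_ (allFin n) (allVecs n m)))
    (cartesianProductWith⁺ _∷_ (λ { refl → refl , refl }) (allFin⁺ n) (allVecs-Unique n m))

∈-allVecs : ∀ n m (v : Vec (Fin n) m) → v ∈ allVecs n m
∈-allVecs n zero [] = here refl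
∈-allVecs n (suc m) (x ∷ v) =
  subst ((x ∷ v) ∈_) (sym (concatMap-map≡cartesianProductWith _∷_ (allFin n) (allVecs n m)))
    (∈-cartesianProductWith⁺ _∷_ (∈-allFin x) (∈-allVecs n m v))

module _ {n : ℕ} where

  private
    -- Sym n lists the tables of the injective maps; unlike functions, tables have decidable equality.
    Vs : List (Vec (Fin n) n)
    Vs = filter (Injective? ∘ lookup) (allVecs n n)

    ∈-filter-Vs⁻ : {P : Fun n → Set} (P? : Decidable P) {v : Vec (Fin n) n} →
      v ∈ filter (P? ∘ lookup) Vs → Injective _≡_ _≡_ (lookup v) × P (lookup v)
    ∈-filter-Vs⁻ P? v∈ with ∈-filter⁻ (P? ∘ lookup) v∈
    ... | v∈Vs , Pv = (λ {i} {j} → proj₂ (∈-filter⁻ (Injective? ∘ lookup) {xs = allVecs n n} v∈Vs) i j) , Pv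

    ∈-filter-Vs⁺ : {P : Fun n → Set} (P? : Decidable P) {v : Vec (Fin n) n} →
      Injective _≡_ _≡_ (lookup v) → P (lookup v) → v ∈ filter (P? ∘ lookup) Vs
    ∈-filter-Vs⁺ P? {v} inj Pv =
      ∈-filter⁺ (P? ∘ lookup) (∈-filter⁺ (Injective? ∘ lookup) (∈-allVecs n n v) (λ _ _ → inj)) Pv

  count-Sym-≤ : {P Q : Fun n → Set} (P? : Decidable P) (Q? : Decidable Q) (G : Fun n → Fun n) →
    (∀ {f g} → f ≗ g → Q f → Q g) →
    (∀ {σ} → Injective _≡_ _≡_ σ → P σ → Injective _≡_ _≡_ (G σ) × Q (G σ)) →
    (∀ {σ σ′} → Injective _≡_ _≡_ σ → Injective _≡_ _≡_ σ′ → P σ → P σ′ → G σ ≗ G σ′ → σ ≗ σ′) →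
    length (filter P? (Sym n)) ≤ length (filter Q? (Sym n))
  count-Sym-≤ P? Q? G Q-resp G-maps G-cancel =
    subst₂ _≤_ (sym (length-filter-map P? lookup Vs)) (sym (length-filter-map Q? lookup Vs))
      (length-≤-injection (≡-dec _≟_) g
        (filter⁺ (P? ∘ lookup) (filter⁺ (Injective? ∘ lookup) (allVecs-Unique n n))) g-maps g-cancel)
    where
    g : Vec (Fin n) n → Vec (Fin n) n
    g v = tabulate (G (lookup v))

    lookup-g : ∀ v → lookup (g v) ≗ G (lookup v)
    lookup-g v = lookup∘tabulate (G (lookup v))

    g-maps : ∀ {v} → v ∈ filter (P? ∘ lookup) Vs → g v ∈ filter (Q? ∘ lookup) Vs
    g-maps {v} v∈ with ∈-filter-Vs⁻ P? v∈
    ... | inj , Pv with G-maps inj Pv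
    ... | G-inj , QG = ∈-filter-Vs⁺ Q?
      (λ {i} {j} e → G-inj (trans (sym (lookup-g v i)) (trans e (lookup-g v j))))
      (Q-resp (sym ∘ lookup-g v) QG)

    g-cancel : ∀ {v w} → v ∈ filter (P? ∘ lookup) Vs → w ∈ filter (P? ∘ lookup) Vs → g v ≡ g w → v ≡ w
    g-cancel {v} {w} v∈ w∈ gv≡gw with ∈-filter-Vs⁻ P? v∈ | ∈-filter-Vs⁻ P? w∈
    ... | inj-v , Pv | inj-w , Pw =
      trans (sym (tabulate∘lookup v)) (trans (tabulate-cong v≗w) (tabulate∘lookup w))
      where
      v≗w : lookup v ≗ lookup w
      v≗w = G-cancel inj-v inj-w Pv Pw λ i →
        trans (sym (lookup-g v i)) (trans (cong (λ u → lookup u i) gv≡gw) (lookup-g w i))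

module _ (f : Fun n) where

  private
    moved? : Decidable (_∈Ts f)
    moved? i = ¬? (f i ≟ i)

    Tc? : Decidable (λ (ij : Fin n × Fin n) → proj₁ ij , proj₂ ij ∈Tc f)
    Tc? ij = ∈Tc? f (proj₁ ij) (proj₂ ij)

    row : Fin n → List (Fin n × Fin n)
    row i = map (i ,_) (allFin n)

    row-count : ∀ i → length (filter Tc? (row i)) ≡ length (filter moved? [ i ])
    row-count i = trans (length-filter-map Tc? (i ,_) (allFin n)) (by-cases (f i ≟ i))
      where
      open ≡-Reasoning
      by-cases : Dec (f i ≡ i) → length (filter (Tc? ∘ (i ,_)) (allFin n)) ≡ length (filter moved? [ i ])
      by-cases (yes fi≡i) = begin
        length (filter (Tc? ∘ (i ,_)) (allFin n))
          ≡⟨ cong length (filter-none (Tc? ∘ (i ,_)) {xs = allFin n} (All.tabulate λ _ → λ { (_ , fi≢i) → fi≢i fi≡i })) ⟩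
        0
          ≡⟨ cong length (filter-reject moved? {xs = []} λ fi≢i → fi≢i fi≡i) ⟨
        length (filter moved? [ i ]) ∎
      by-cases (no fi≢i) = begin
        length (filter (Tc? ∘ (i ,_)) (allFin n))
          ≡⟨ cong length (filter-≐ (Tc? ∘ (i ,_)) (f i ≟_) (proj₁ , (_, fi≢i)) (allFin n)) ⟩
        length (filter (f i ≟_) (allFin n))
          ≡⟨ length-filter-≟-Unique _≟_ (f i) (allFin⁺ n) (∈-allFin (f i)) ⟩
        1
          ≡⟨ cong length (filter-accept moved? {xs = []} fi≢i) ⟨
        length (filter moved? [ i ]) ∎

    rows-count : ∀ is → length (filter Tc? (concatMap row is)) ≡ length (filter moved? is)
    rows-count [] = refl
    rows-count (i ∷ is) = begin
      length (filter Tc? (row i ++ concatMap row is))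
        ≡⟨ cong length (filter-++ Tc? (row i) (concatMap row is)) ⟩
      length (filter Tc? (row i) ++ filter Tc? (concatMap row is))
        ≡⟨ length-++ (filter Tc? (row i)) ⟩
      length (filter Tc? (row i)) + length (filter Tc? (concatMap row is))
        ≡⟨ cong₂ _+_ (row-count i) (rows-count is) ⟩
      length (filter moved? [ i ]) + length (filter moved? is)
        ≡⟨ sym (length-++ (filter moved? [ i ])) ⟩
      length (filter moved? [ i ] ++ filter moved? is)
        ≡⟨ cong length (filter-++ moved? [ i ] is) ⟨
      length (filter moved? (i ∷ is)) ∎
      where open ≡-Reasoning

  ∣Tc∣≡wH : ∣Tc∣ f ≡ wH f
  ∣Tc∣≡wH = rows-count (allFin n)

∣Tc∣-cong-Ts : (f g : Fun n) → (∀ i → i ∈Ts f → i ∈Ts g) → (∀ i → i ∈Ts g → i ∈Ts f) →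
  ∣Tc∣ f ≡ ∣Tc∣ g
∣Tc∣-cong-Ts {n} f g f⊆g g⊆f = begin
  ∣Tc∣ f ≡⟨ ∣Tc∣≡wH f ⟩
  wH f   ≡⟨ cong length (filter-≐ _ _ ((λ {i} → f⊆g i) , (λ {i} → g⊆f i)) (allFin n)) ⟩
  wH g   ≡⟨ ∣Tc∣≡wH g ⟨
  ∣Tc∣ g ∎
  where open ≡-Reasoning

∣Tc∣-resp-≗ : {f g : Fun n} → f ≗ g → ∣Tc∣ f ≡ ∣Tc∣ g
∣Tc∣-resp-≗ {f = f} {g} f≗g =
  ∣Tc∣-cong-Ts f g (λ x fx≢x → fx≢x ∘ trans (f≗g x)) (λ x gx≢x → gx≢x ∘ trans (sym (f≗g x)))

TcSub-resp-≗ : {f g p : Fun n} → f ≗ g → TcSub f p → TcSub g p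
TcSub-resp-≗ f≗g f⊆p x y (gx≡y , gx≢x) = f⊆p x y (trans (f≗g x) gx≡y , gx≢x ∘ trans (sym (f≗g x)))

Orbit : Fun n → Fin n → Fin n → Set
Orbit f = Star (λ x z → f x ≡ z)

orbit-closed : (f : Fun n) {P : Fin n → Set} → (∀ {x} → P x → P (f x)) →
  ∀ {x z} → P x → Orbit f x z → P z
orbit-closed f closed Px ε = Px
orbit-closed f closed Px (refl ◅ path) = orbit-closed f closed (closed Px) path

module _ {σ b : Fun n} (σ⊆b : TcSub σ b) where

  agrees-on-support : ∀ {x} → x ∈Ts σ → σ x ≡ b x
  agrees-on-support {x} x∈σ = sym (proj₁ (σ⊆b x (σ x) (refl , x∈σ)))

  support-⊆ : ∀ {x} → x ∈Ts σ → x ∈Ts b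
  support-⊆ x∈σ = x∈σ ∘ trans (agrees-on-support x∈σ)

  support-closed : Injective _≡_ _≡_ σ → ∀ {x} → x ∈Ts σ → b x ∈Ts σ
  support-closed σ-inj {x} x∈σ σbx≡bx = x∈σ (σ-inj (begin
    σ (σ x) ≡⟨ cong σ (agrees-on-support x∈σ) ⟩
    σ (b x) ≡⟨ σbx≡bx ⟩
    b x     ≡⟨ agrees-on-support x∈σ ⟨
    σ x     ∎))
    where open ≡-Reasoning

restrict : Fun n → Fun n → Fun n
restrict p σ x with σ x ≟ x
... | yes _ = x
... | no _ = p x

module _ (p σ : Fun n) where

  restrict-fixed : ∀ {x} → σ x ≡ x → restrict p σ x ≡ x
  restrict-fixed {x} σx≡x with σ x ≟ x
  ... | yes _ = refl
  ... | no σx≢x = contradiction σx≡x σx≢x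

  restrict-moved : ∀ {x} → x ∈Ts σ → restrict p σ x ≡ p x
  restrict-moved {x} x∈σ with σ x ≟ x
  ... | yes σx≡x = contradiction σx≡x x∈σ
  ... | no _ = refl

  restrict-TcSub : TcSub (restrict p σ) p
  restrict-TcSub x y (rx≡y , rx≢x) = trans (sym (restrict-moved x∈σ)) rx≡y , rx≢x ∘ trans (restrict-moved x∈σ)
    where
    x∈σ : x ∈Ts σ
    x∈σ = rx≢x ∘ restrict-fixed

  restrict-Ts⁻ : ∀ x → x ∈Ts restrict p σ → x ∈Ts σ
  restrict-Ts⁻ x rx≢x = rx≢x ∘ restrict-fixed

  restrict-Ts⁺ : ∀ x → x ∈Ts σ → x ∈Ts p → x ∈Ts restrict p σ
  restrict-Ts⁺ x x∈σ x∈p = x∈p ∘ trans (sym (restrict-moved x∈σ))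

  restrict-injective : Injective _≡_ _≡_ p → (∀ {x} → x ∈Ts σ → p x ∈Ts σ) →
    Injective _≡_ _≡_ (restrict p σ)
  restrict-injective p-inj closed {x} {x′} rx≡rx′ with σ x ≟ x | σ x′ ≟ x′
  ... | yes _ | yes _ = rx≡rx′
  ... | no _ | no _ = p-inj rx≡rx′
  ... | yes σx≡x | no x′∈σ = ⊥-elim (closed x′∈σ (subst (λ z → σ z ≡ z) rx≡rx′ σx≡x))
  ... | no x∈σ | yes σx′≡x′ = ⊥-elim (closed x∈σ (subst (λ z → σ z ≡ z) (sym rx≡rx′) σx′≡x′))

restrict-cancel : {p b σ σ′ : Fun n} → (∀ x → x ∈Ts b → x ∈Ts p) → TcSub σ b → TcSub σ′ b →
  ∀ x → restrict p σ x ≡ restrict p σ′ x → σ x ≡ σ′ x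
restrict-cancel {σ = σ} {σ′} b⊆p σ⊆b σ′⊆b x rx≡r′x with σ x ≟ x | σ′ x ≟ x
... | yes σx≡x | yes σ′x≡x = trans σx≡x (sym σ′x≡x)
... | no x∈σ | no x∈σ′ = trans (agrees-on-support σ⊆b x∈σ) (sym (agrees-on-support σ′⊆b x∈σ′))
... | yes _ | no x∈σ′ = contradiction (sym rx≡r′x) (b⊆p x (support-⊆ σ′⊆b x∈σ′))
... | no x∈σ | yes _ = contradiction rx≡r′x (b⊆p x (support-⊆ σ⊆b x∈σ))

∣N∣-mono : {p b : Fun n} → Injective _≡_ _≡_ p → (∀ x → x ∈Ts b → x ∈Ts p) →
  (∀ x → Orbit b x (p x)) → ∀ m → ∣N∣ m b ≤ ∣N∣ m p
∣N∣-mono {p = p} {b} p-inj b⊆p orbit m =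
  count-Sym-≤ _ _ (restrict p) resp maps cancel
  where
  cancel : ∀ {σ σ′} → Injective _≡_ _≡_ σ → Injective _≡_ _≡_ σ′ →
    TcSub σ b × ∣Tc∣ σ ≡ m → TcSub σ′ b × ∣Tc∣ σ′ ≡ m → restrict p σ ≗ restrict p σ′ → σ ≗ σ′
  cancel _ _ (σ⊆b , _) (σ′⊆b , _) r≗r′ x = restrict-cancel b⊆p σ⊆b σ′⊆b x (r≗r′ x)

  resp : ∀ {f g} → f ≗ g → TcSub f p × ∣Tc∣ f ≡ m → TcSub g p × ∣Tc∣ g ≡ m
  resp f≗g (f⊆p , ∣f∣≡m) = TcSub-resp-≗ f≗g f⊆p , trans (sym (∣Tc∣-resp-≗ f≗g)) ∣f∣≡m

  maps : ∀ {σ} → Injective _≡_ _≡_ σ → TcSub σ b × ∣Tc∣ σ ≡ m →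
    Injective _≡_ _≡_ (restrict p σ) × TcSub (restrict p σ) p × ∣Tc∣ (restrict p σ) ≡ m
  maps {σ} σ-inj (σ⊆b , ∣σ∣≡m) =
    restrict-injective p σ p-inj (λ {x} x∈σ → orbit-closed b {_∈Ts σ} (support-closed σ⊆b σ-inj) x∈σ (orbit x)) ,
    restrict-TcSub p σ ,
    trans (∣Tc∣-cong-Ts _ σ (restrict-Ts⁻ p σ) λ x x∈σ → restrict-Ts⁺ p σ x x∈σ (b⊆p x (support-⊆ σ⊆b x∈σ))) ∣σ∣≡m

-- b has the cycle (y 0 … y l), which p splits into (y 0 … y (s ∸ 1)) and (y s … y l)

module SplitCycle {b p : Fun n} {l s : ℕ} {y : ℕ → Fin n} (s≤l : s ≤ l)
  (b-step : ∀ k → suc k < suc l → b (y k) ≡ y (suc k)) (b-close : b (y l) ≡ y 0)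
  (p-step₁ : ∀ k → suc k < s → p (y k) ≡ y (suc k)) (p-close₁ : p (y (s ∸ 1)) ≡ y 0)
  (p-step₂ : ∀ k → s ≤ k → suc k < suc l → p (y k) ≡ y (suc k)) (p-close₂ : p (y l) ≡ y s)
  (p-outside : ∀ x → (∀ k → k < suc l → x ≢ y k) → p x ≡ b x) where

  b-path : ∀ {k j} → k ≤′ j → j ≤ l → Orbit b (y k) (y j)
  b-path ≤′-refl _ = ε
  b-path (≤′-step {j} k≤′j) j<l = b-path k≤′j (<⇒≤ j<l) ◅◅ b-step j (s≤s j<l) ◅ ε

  b-connected : ∀ {k j} → k ≤ l → j ≤ l → Orbit b (y k) (y j)
  b-connected k≤l j≤l = b-path (≤⇒≤′ k≤l) ≤-refl ◅◅ b-close ◅ b-path (≤⇒≤′ z≤n) j≤l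

  p-on-cycle : ∀ {k} → k ≤ l → ∃[ j ] j ≤ l × p (y k) ≡ y j
  p-on-cycle {k} k≤l with m≤n⇒m<n∨m≡n k≤l | <-cmp (suc k) s
  ... | inj₂ refl | _ = s , s≤l , p-close₂
  ... | inj₁ k<l | tri< k+1<s _ _ = suc k , k<l , p-step₁ k k+1<s
  ... | inj₁ _ | tri≈ _ k+1≡s _ = 0 , z≤n , subst (λ z → p (y z) ≡ y 0) (cong (_∸ 1) (sym k+1≡s)) p-close₁
  ... | inj₁ k<l | tri> _ _ s<k+1 = suc k , k<l , p-step₂ k (≤-pred s<k+1) (s≤s k<l)

  p-within-orbits : ∀ x → Orbit b x (p x)
  p-within-orbits x with anyUpTo? (λ k → x ≟ y k) (suc l)
  ... | yes (k , k<l+1 , refl) with p-on-cycle (≤-pred k<l+1)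
  ...   | j , j≤l , pyk≡yj = subst (Orbit b (y k)) (sym pyk≡yj) (b-connected (≤-pred k<l+1) j≤l)
  p-within-orbits x | no x∉y = sym (p-outside x λ k k<l+1 x≡yk → x∉y (k , k<l+1 , x≡yk)) ◅ ε

lemma11 : (n r : ℕ) (π β : Permutation′ n) →
    2 ≤ r →
    wH (perm π) ≡ 2 * r ∸ 1 → wH (perm β) ≡ 2 * r ∸ 1 → 2 * r ∸ 1 ≤ n →
    (∀ i → (i ∈Ts perm π) ⇔ (i ∈Ts perm β)) →
    (t s : ℕ) (y : ℕ → Fin n) →
    2 ≤ s → s ≤ t ∸ 2 →
    (∀ k l → k < t → l < t → y k ≡ y l → k ≡ l) →
    (∀ k → suc k < t → perm β (y k) ≡ y (suc k)) →
    perm β (y (t ∸ 1)) ≡ y 0 →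
    (∀ k → suc k < s → perm π (y k) ≡ y (suc k)) →
    perm π (y (s ∸ 1)) ≡ y 0 →
    (∀ k → s ≤ k → suc k < t → perm π (y k) ≡ y (suc k)) →
    perm π (y (t ∸ 1)) ≡ y s →
    (∀ x → (∀ k → k < t → x ≢ y k) → perm π x ≡ perm β x) →
    (∣N₁∣ r (perm β) ≤ ∣N₁∣ r (perm π)) × (∣N₂∣ r (perm β) ≤ ∣N₂∣ r (perm π))
lemma11 _ _ _ _ _ _ _ _ _ zero _ _ 2≤s s≤0 _ _ _ _ _ _ _ _ = contradiction (≤-trans 2≤s s≤0) λ ()
lemma11 _ r π β _ _ _ _ Ts⇔ (suc l) _ _ _ s≤l∸1 _ β-step β-close π-step₁ π-close₁ π-step₂ π-close₂ π-outside =
  mono (r ∸ 1) , mono r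
  where
  π-within-β-orbits : ∀ x → Orbit (perm β) x (perm π x)
  π-within-β-orbits = SplitCycle.p-within-orbits (≤-trans s≤l∸1 (m∸n≤m l 1))
    β-step β-close π-step₁ π-close₁ π-step₂ π-close₂ π-outside

  mono : ∀ m → ∣N∣ m (perm β) ≤ ∣N∣ m (perm π)
  mono = ∣N∣-mono (Injection.injective (↔⇒↣ π)) (Equivalence.from ∘ Ts⇔) π-within-β-orbits
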